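{- For every pair of positive integers $t$ and $p$, with $k=3^t5^p$ and $n=2^{2t+3p}$, there exists an antipodal $k$-splitting of $Q_2^{n}$.
   Context: $Q_2^n=\{0,1\}^n$ is the $n$-dimensional Boolean hypercube. An $m$-face of $Q_2^n$ is given by a tuple $(a_1,\dots,a_n)\in\{0,1,*\}^n$ with exactly $m$ entries equal to $*$; it is the set $\{(x_1,\dots,x_n)\in Q_2^n : x_i=a_i \text{ whenever } a_i\in\{0,1\}\}$. Its direction is the set of positions $i$ with $a_i=*$. Two faces are parallel if they have the same direction; two parallel faces $a,b$ are antipodal if $b_i=1-a_i$ for every $i$ with $a_i\neq *$. An antipodal $k$-splitting of $Q_2^n$ is a collection of exactly $2^k$ faces of dimension $n-k$ whose union is $Q_2^n$ and which contains no two distinct parallel faces that are not antipodal. -}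

module Defs where

open import Data.Nat using (ℕ; zero; suc; _+_)
open import Data.Bool using (Bool; true; false)
open import Data.Fin using (Fin)
open import Data.Vec using (Vec; []; _∷_; lookup)
open import Data.List using (List; length)
open import Data.List.Membership.Propositional using (_∈_)
open import Data.List.Relation.Unary.Unique.Propositional using (Unique)
open import Data.Product using (_×_; Σ)
open import Relation.Binary.PropositionalEquality using (_≡_)
open import Relation.Nullary using (¬_)

data Sym : Set where
  s0 s1 star : Sym

-- A face of Q_2^n: a tuple in {0,1,*}^n
Face : ℕ → Set
Face n = Vec Sym n

Vertex : ℕ → Set
Vertex n = Vec Bool n

dim : ∀ {n} → Face n → ℕ
dim []           = 0
dim (star ∷ a)   = suc (dim a)
dim (s0 ∷ a)     = dim a
dim (s1 ∷ a)     = dim a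

data Matches : Sym → Bool → Set where
  m-star : ∀ {b} → Matches star b
  m-0    : Matches s0 false
  m-1    : Matches s1 true

_∈F_ : ∀ {n} → Vertex n → Face n → Set
x ∈F a = ∀ i → Matches (lookup a i) (lookup x i)

Parallel : ∀ {n} → Face n → Face n → Set
Parallel a b = ∀ i → (lookup a i ≡ star → lookup b i ≡ star)
                   × (lookup b i ≡ star → lookup a i ≡ star)

flipS : Sym → Sym
flipS s0   = s1
flipS s1   = s0
flipS star = star

Antipodal : ∀ {n} → Face n → Face n → Set
Antipodal a b = Parallel a b × (∀ i → ¬ (lookup a i ≡ star) → lookup b i ≡ flipS (lookup a i))

record AntipodalSplitting (n k : ℕ) : Set where
  field
    faces     : List (Face n)
    distinct  : Unique faces
    count     : length faces ≡ 2 Data.Nat.^ k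
    dimension : ∀ {a} → a ∈ faces → dim a + k ≡ n
    covers    : ∀ (x : Vertex n) → Σ (Face n) (λ a → a ∈ faces × x ∈F a)
    antipodal : ∀ {a b} → a ∈ faces → b ∈ faces → ¬ (a ≡ b) → Parallel a b → Antipodal a b

-- Call an antipodal splitting signed when its faces are indexed by bit vectors so that
-- flipping the first bit passes to the antipodal face and parallel faces agree in all other
-- bits.  Signed splittings multiply: cut Q₂^(n₁n₂) into n₁ blocks of n₂ coordinates, take a
-- face a of a signed k₁-splitting of Q₂^n₁, fill the blocks at the stars of a with stars and
-- the block at a fixed coordinate of a with a face of a signed k₂-splitting of Q₂^n₂ whose
-- sign is the value of that coordinate.  Choosing a and the k₁ inner faces independently
-- gives 2^(k₁k₂) faces forming a signed k₁k₂-splitting of Q₂^(n₁n₂).  Powers of explicit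
-- signed 3- and 5-splittings of Q₂⁴ and Q₂⁸, checked by evaluation, give the theorem.

module Submission where

open import Defs
open import Data.Nat using (ℕ; zero; suc; _+_; _*_; _^_; _≥_)
import Data.Nat as ℕ
open import Data.Nat.Properties using (+-suc; +-identityʳ; *-suc; ^-distribˡ-+-*; ^-*-assoc)
open import Data.Bool using (Bool; true; false; not)
import Data.Bool as Bool
open import Data.Vec using (Vec; []; _∷_; _++_; concat; replicate; map; head; tail; toList; cast; splitAt; group)
open import Data.Vec.Properties
  using (map-∘; map-cong; map-id; map-replicate; map-concat; lookup-map; ++-injective; toList-injective; toList-cast; cast-is-id; cast-trans; ≡-dec)
open import Data.Vec.Relation.Binary.Pointwise.Inductive as Pointwise using (Pointwise; []; _∷_)
import Data.Vec.Relation.Binary.Pointwise.Extensional as Extensional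
open import Data.List as List using (List)
open import Data.List.Properties using (length-++; length-map)
open import Data.List.Membership.Propositional using (_∈_; lose)
open import Data.List.Membership.Propositional.Properties using (∈-map⁺; ∈-map⁻; ∈-++⁺ˡ; ∈-++⁺ʳ)
import Data.List.Relation.Unary.All as All
import Data.List.Relation.Unary.Any as Any
open import Data.List.Relation.Unary.AllPairs using ([]; _∷_)
open import Data.List.Relation.Unary.Unique.Propositional using (Unique)
import Data.List.Relation.Unary.Unique.Propositional.Properties as Unique
open import Data.Product as Prod using (_×_; _,_; proj₁; proj₂; ∃-syntax; uncurry; swap)
open import Data.Sum using (_⊎_; inj₁; inj₂)
open import Data.Empty using (⊥-elim)
open import Function using (_∘_; id)
open import Relation.Binary.PropositionalEquality
open import Relation.Nullary using (¬_; Dec; yes; no)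
open import Relation.Nullary.Decidable using (True; toWitness; map′; _×-dec_; _→-dec_)

anti : ∀ {n} → Face n → Face n
anti = map flipS

stars : ∀ {n} → Face n
stars = replicate _ star

codim : ∀ {n} → Face n → ℕ
codim []         = 0
codim (star ∷ a) = codim a
codim (s0 ∷ a)   = suc (codim a)
codim (s1 ∷ a)   = suc (codim a)

dim+codim : ∀ {n} (a : Face n) → dim a + codim a ≡ n
dim+codim []         = refl
dim+codim (star ∷ a) = cong suc (dim+codim a)
dim+codim (s0 ∷ a)   = trans (+-suc (dim a) (codim a)) (cong suc (dim+codim a))
dim+codim (s1 ∷ a)   = trans (+-suc (dim a) (codim a)) (cong suc (dim+codim a))

codim-++ : ∀ {m n} (a : Face m) (b : Face n) → codim (a ++ b) ≡ codim a + codim b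
codim-++ []         b = refl
codim-++ (star ∷ a) b = codim-++ a b
codim-++ (s0 ∷ a)   b = cong suc (codim-++ a b)
codim-++ (s1 ∷ a)   b = cong suc (codim-++ a b)

codim-stars : ∀ n → codim (stars {n}) ≡ 0
codim-stars zero    = refl
codim-stars (suc n) = codim-stars n

flipS-involutive : ∀ s → flipS (flipS s) ≡ s
flipS-involutive s0   = refl
flipS-involutive s1   = refl
flipS-involutive star = refl

anti-involutive : ∀ {n} (a : Face n) → anti (anti a) ≡ a
anti-involutive a = trans (sym (map-∘ flipS flipS a)) (trans (map-cong flipS-involutive a) (map-id a))

anti-stars : ∀ {n} → anti (stars {n}) ≡ stars
anti-stars {n} = map-replicate flipS star n

≡anti⇒codim≡0 : ∀ {n} (a : Face n) → a ≡ anti a → codim a ≡ 0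
≡anti⇒codim≡0 []         _  = refl
≡anti⇒codim≡0 (star ∷ a) eq = ≡anti⇒codim≡0 a (cong tail eq)
≡anti⇒codim≡0 (s0 ∷ a)   ()
≡anti⇒codim≡0 (s1 ∷ a)   ()

_∥ₛ_ : Sym → Sym → Set
s ∥ₛ t = (s ≡ star → t ≡ star) × (t ≡ star → s ≡ star)

_∥_ : ∀ {n} → Face n → Face n → Set
a ∥ b = Pointwise _∥ₛ_ a b

∥-refl : ∀ {n} {a : Face n} → a ∥ a
∥-refl = Pointwise.refl (id , id)

∥-sym : ∀ {n} {a b : Face n} → a ∥ b → b ∥ a
∥-sym = Pointwise.sym swap

∥-anti : ∀ {n} (a : Face n) → a ∥ anti a
∥-anti []         = []
∥-anti (s0 ∷ a)   = ((λ ()) , (λ ())) ∷ ∥-anti a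
∥-anti (s1 ∷ a)   = ((λ ()) , (λ ())) ∷ ∥-anti a
∥-anti (star ∷ a) = (id , id) ∷ ∥-anti a

∥-stars⇒codim≡0 : ∀ {n} (a : Face n) → a ∥ stars → codim a ≡ 0
∥-stars⇒codim≡0 []         []                = refl
∥-stars⇒codim≡0 (star ∷ a) (_ ∷ p)           = ∥-stars⇒codim≡0 a p
∥-stars⇒codim≡0 (s0 ∷ a)   ((_ , fixed) ∷ _) with fixed refl
... | ()
∥-stars⇒codim≡0 (s1 ∷ a)   ((_ , fixed) ∷ _) with fixed refl
... | ()

_∋_ : ∀ {n} → Face n → Vertex n → Set
a ∋ x = Pointwise Matches a x

stars-∋ : ∀ {n} (x : Vertex n) → stars ∋ x
stars-∋ []      = []
stars-∋ (_ ∷ x) = m-star ∷ stars-∋ x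

∋⇒∈F : ∀ {n} {a : Face n} {x : Vertex n} → a ∋ x → x ∈F a
∋⇒∈F = Pointwise.lookup

Parallel⇒∥ : ∀ {n} {a b : Face n} → Parallel a b → a ∥ b
Parallel⇒∥ p = Extensional.extensional⇒inductive (Extensional.ext p)

antipodal-anti : ∀ {n} (a : Face n) → Antipodal a (anti a)
antipodal-anti a = Pointwise.lookup (∥-anti a) , λ i _ → lookup-map i flipS a

Matches? : ∀ s b → Dec (Matches s b)
Matches? star _     = yes m-star
Matches? s0   false = yes m-0
Matches? s0   true  = no λ ()
Matches? s1   true  = yes m-1
Matches? s1   false = no λ ()

_≟star : ∀ s → Dec (s ≡ star)
star ≟star = yes refl
s0   ≟star = no λ ()
s1   ≟star = no λ ()

_∥ₛ?_ : ∀ s t → Dec (s ∥ₛ t)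
s ∥ₛ? t = (s ≟star →-dec t ≟star) ×-dec (t ≟star →-dec s ≟star)

allBits : ∀ k → List (Vec Bool k)
allBits zero    = List.[ [] ]
allBits (suc k) = List.map (true ∷_) (allBits k) List.++ List.map (false ∷_) (allBits k)

allBits-complete : ∀ {k} (v : Vec Bool k) → v ∈ allBits k
allBits-complete []          = Any.here refl
allBits-complete (true ∷ v)  = ∈-++⁺ˡ (∈-map⁺ (true ∷_) (allBits-complete v))
allBits-complete (false ∷ v) = ∈-++⁺ʳ (List.map (true ∷_) _) (∈-map⁺ (false ∷_) (allBits-complete v))

allBits-length : ∀ k → List.length (allBits k) ≡ 2 ^ k
allBits-length zero    = refl
allBits-length (suc k) = begin
  List.length (List.map (true ∷_) bits List.++ List.map (false ∷_) bits)
    ≡⟨ length-++ (List.map (true ∷_) bits) ⟩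
  List.length (List.map (true ∷_) bits) + List.length (List.map (false ∷_) bits)
    ≡⟨ cong₂ _+_ (length-map (true ∷_) bits) (length-map (false ∷_) bits) ⟩
  List.length bits + List.length bits
    ≡⟨ cong₂ _+_ (allBits-length k) (trans (allBits-length k) (sym (+-identityʳ (2 ^ k)))) ⟩
  2 ^ suc k ∎
  where
  open ≡-Reasoning
  bits = allBits k

allBits-unique : ∀ k → Unique (allBits k)
allBits-unique zero    = All.[] ∷ []
allBits-unique (suc k) = Unique.++⁺ (Unique.map⁺ (cong tail) (allBits-unique k))
                                    (Unique.map⁺ (cong tail) (allBits-unique k)) disjoint
  where
  disjoint : ∀ {v} → ¬ (v ∈ List.map (true ∷_) (allBits k) × v ∈ List.map (false ∷_) (allBits k))
  disjoint (p , q) with ∈-map⁻ (true ∷_) p | ∈-map⁻ (false ∷_) q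
  ... | _ , _ , refl | _ , _ , ()

all-bits? : ∀ {k} {P : Vec Bool k → Set} → (∀ v → Dec (P v)) → Dec (∀ v → P v)
all-bits? P? = map′ (λ all v → All.lookup all (allBits-complete v))
                    (λ ∀P → All.tabulate λ {v} _ → ∀P v)
                    (All.all? P? (allBits _))

any-bits? : ∀ {k} {P : Vec Bool k → Set} → (∀ v → Dec (P v)) → Dec (∃[ v ] P v)
any-bits? P? = map′ Any.satisfied
                    (λ (v , p) → lose (allBits-complete v) p)
                    (Any.any? P? (allBits _))

module _ {A : Set} where

  joinRows : ∀ {p q r} → Vec A p → Vec (Vec A r) q → Vec A (p + q * r)
  joinRows c rows = c ++ concat rows

  splitRows : ∀ p q r → Vec A (p + q * r) → Vec A p × Vec (Vec A r) q
  splitRows p q r v = let c , rest , _ = splitAt p v in c , proj₁ (group q r rest)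

  joinRows-splitRows : ∀ p q r (v : Vec A (p + q * r)) → uncurry joinRows (splitRows p q r v) ≡ v
  joinRows-splitRows p q r v =
    let c , rest , v≡c++rest = splitAt p v
    in trans (cong (c ++_) (sym (proj₂ (group q r rest)))) (sym v≡c++rest)

  concat-injective : ∀ {q r} (xss yss : Vec (Vec A r) q) → concat xss ≡ concat yss → xss ≡ yss
  concat-injective []         []         _  = refl
  concat-injective (xs ∷ xss) (ys ∷ yss) eq =
    let xs≡ys , rest≡ = ++-injective xs ys eq
    in cong₂ _∷_ xs≡ys (concat-injective xss yss rest≡)

  splitRows-joinRows : ∀ {p q r} (c : Vec A p) (rows : Vec (Vec A r) q) →
                       splitRows p q r (joinRows c rows) ≡ (c , rows)
  splitRows-joinRows {p} {q} {r} c rows =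
    let c′ , rows′ = splitRows p q r (joinRows c rows)
        c′≡c , rest≡ = ++-injective c′ c (joinRows-splitRows p q r (joinRows c rows))
    in cong₂ _,_ c′≡c (concat-injective rows′ rows rest≡)

  tail-joinRows : ∀ {p q r} (c : Vec A (suc p)) (rows : Vec (Vec A r) q) →
                  tail (joinRows c rows) ≡ tail c ++ concat rows
  tail-joinRows (_ ∷ _) _ = refl

record SignedSplitting (n m : ℕ) : Set where
  field
    face       : Vec Bool (suc m) → Face n
    face-flip  : ∀ b c → face (not b ∷ c) ≡ anti (face (b ∷ c))
    codim-face : ∀ v → codim (face v) ≡ suc m
    cover      : ∀ x → ∃[ v ] face v ∋ x
    ∥⇒tail≡    : ∀ v w → face v ∥ face w → tail v ≡ tail w

  face-sign : ∀ b b′ c → b ≡ b′ ⊎ face (b′ ∷ c) ≡ anti (face (b ∷ c))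
  face-sign false false _ = inj₁ refl
  face-sign true  true  _ = inj₁ refl
  face-sign false true  c = inj₂ (face-flip false c)
  face-sign true  false c = inj₂ (face-flip true c)

  face-∦-stars : ∀ v → ¬ face v ∥ stars
  face-∦-stars v p with trans (sym (codim-face v)) (∥-stars⇒codim≡0 (face v) p)
  ... | ()

  face-≢-anti : ∀ v → face v ≢ anti (face v)
  face-≢-anti v eq with trans (sym (codim-face v)) (≡anti⇒codim≡0 (face v) eq)
  ... | ()

  face-injective : ∀ {v w} → face v ≡ face w → v ≡ w
  face-injective {b ∷ c} {b′ ∷ c′} eq with ∥⇒tail≡ (b ∷ c) (b′ ∷ c′) (subst (face (b ∷ c) ∥_) eq ∥-refl)
  ... | refl with face-sign b b′ c
  ... | inj₁ refl = refl
  ... | inj₂ eq′  = ⊥-elim (face-≢-anti (b ∷ c) (trans eq eq′))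

  antipodalSplitting : AntipodalSplitting n (suc m)
  antipodalSplitting = record
    { faces     = List.map face (allBits (suc m))
    ; distinct  = Unique.map⁺ face-injective (allBits-unique (suc m))
    ; count     = trans (length-map face (allBits (suc m))) (allBits-length (suc m))
    ; dimension = dimension
    ; covers    = λ x → let v , v∋x = cover x in face v , ∈-map⁺ face (allBits-complete v) , ∋⇒∈F v∋x
    ; antipodal = antipodal
    }
    where
    dimension : ∀ {a} → a ∈ List.map face (allBits (suc m)) → dim a + suc m ≡ n
    dimension a∈ with ∈-map⁻ face a∈
    ... | v , _ , refl = trans (cong (dim (face v) +_) (sym (codim-face v))) (dim+codim (face v))

    antipodal : ∀ {a a′} → a ∈ List.map face (allBits (suc m)) → a′ ∈ List.map face (allBits (suc m)) →
                a ≢ a′ → Parallel a a′ → Antipodal a a′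
    antipodal a∈ a′∈ a≢a′ a∥a′ with ∈-map⁻ face a∈ | ∈-map⁻ face a′∈
    ... | b ∷ c , _ , refl | b′ ∷ c′ , _ , refl with ∥⇒tail≡ (b ∷ c) (b′ ∷ c′) (Parallel⇒∥ a∥a′)
    ... | refl with face-sign b b′ c
    ... | inj₁ refl = ⊥-elim (a≢a′ refl)
    ... | inj₂ eq   = subst (Antipodal (face (b ∷ c))) (sym eq) (antipodal-anti (face (b ∷ c)))

module Product {n₁ m₁ n₂ m₂ : ℕ} (A : SignedSplitting n₁ m₁) (B : SignedSplitting n₂ m₂) where
  private
    module A = SignedSplitting A
    module B = SignedSplitting B

  Chunk : Set
  Chunk = Vec Bool m₂

  blocks : ∀ {k} (a : Face k) → Vec Chunk (codim a) → Vec (Face n₂) k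
  blocks []         []       = []
  blocks (star ∷ a) cs       = stars ∷ blocks a cs
  blocks (s0 ∷ a)   (c ∷ cs) = B.face (false ∷ c) ∷ blocks a cs
  blocks (s1 ∷ a)   (c ∷ cs) = B.face (true ∷ c) ∷ blocks a cs

  substitute : ∀ {k} (a : Face k) → Vec Chunk (codim a) → Face (k * n₂)
  substitute a cs = concat (blocks a cs)

  codim-substitute : ∀ {k} (a : Face k) (cs : Vec Chunk (codim a)) →
                     codim (substitute a cs) ≡ codim a * suc m₂
  codim-substitute []         []       = refl
  codim-substitute (star ∷ a) cs       =
    trans (codim-++ (stars {n₂}) (substitute a cs)) (cong₂ _+_ (codim-stars n₂) (codim-substitute a cs))
  codim-substitute (s0 ∷ a)   (c ∷ cs) =
    trans (codim-++ (B.face _) (substitute a cs)) (cong₂ _+_ (B.codim-face _) (codim-substitute a cs))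
  codim-substitute (s1 ∷ a)   (c ∷ cs) =
    trans (codim-++ (B.face _) (substitute a cs)) (cong₂ _+_ (B.codim-face _) (codim-substitute a cs))

  blocks-anti : ∀ {k} (a : Face k) (cs : Vec Chunk (codim a)) .(e : codim a ≡ codim (anti a)) →
                blocks (anti a) (cast e cs) ≡ map anti (blocks a cs)
  blocks-anti []         []       _ = refl
  blocks-anti (star ∷ a) cs       e = cong₂ _∷_ (sym anti-stars) (blocks-anti a cs e)
  blocks-anti (s0 ∷ a)   (c ∷ cs) e = cong₂ _∷_ (B.face-flip false c) (blocks-anti a cs (cong ℕ.pred e))
  blocks-anti (s1 ∷ a)   (c ∷ cs) e = cong₂ _∷_ (B.face-flip true c) (blocks-anti a cs (cong ℕ.pred e))

  substitute-anti : ∀ {k j} {a a′ : Face k} → a′ ≡ anti a → (rows : Vec Chunk j)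
                    .(e : j ≡ codim a) .(e′ : j ≡ codim a′) →
                    substitute a′ (cast e′ rows) ≡ anti (substitute a (cast e rows))
  substitute-anti {a = a} refl rows e e′ = begin
    concat (blocks (anti a) (cast e′ rows))
      ≡⟨ cong (concat ∘ blocks (anti a)) (cast-trans e (trans (sym e) e′) rows) ⟨
    concat (blocks (anti a) (cast (trans (sym e) e′) (cast e rows)))
      ≡⟨ cong concat (blocks-anti a (cast e rows) (trans (sym e) e′)) ⟩
    concat (map anti (blocks a (cast e rows)))
      ≡⟨ map-concat flipS (blocks a (cast e rows)) ⟨
    anti (substitute a (cast e rows)) ∎
    where open ≡-Reasoning

  fixed-∷-∥ : ∀ {k b b′ c c′} {s s′ : Sym} {a a′ : Face k} {l l′ : List Chunk} →
              s ≢ star → s′ ≢ star → B.face (b ∷ c) ∥ B.face (b′ ∷ c′) → a ∥ a′ × l ≡ l′ →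
              (s ∷ a) ∥ (s′ ∷ a′) × c List.∷ l ≡ c′ List.∷ l′
  fixed-∷-∥ s≢star s′≢star p (a∥a′ , l≡l′) =
    ((⊥-elim ∘ s≢star) , (⊥-elim ∘ s′≢star)) ∷ a∥a′ , cong₂ List._∷_ (B.∥⇒tail≡ _ _ p) l≡l′

  blocks-∥ : ∀ {k} (a a′ : Face k) (cs : Vec Chunk (codim a)) (cs′ : Vec Chunk (codim a′)) →
             Pointwise _∥_ (blocks a cs) (blocks a′ cs′) → a ∥ a′ × toList cs ≡ toList cs′
  blocks-∥ []         []          []       []         []       = [] , refl
  blocks-∥ (star ∷ a) (star ∷ a′) cs       cs′        (_ ∷ ps) = Prod.map₁ ((id , id) ∷_) (blocks-∥ a a′ cs cs′ ps)
  blocks-∥ (star ∷ _) (s0 ∷ _)    _        (_ ∷ _)    (p ∷ _)  = ⊥-elim (B.face-∦-stars _ (∥-sym p))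
  blocks-∥ (star ∷ _) (s1 ∷ _)    _        (_ ∷ _)    (p ∷ _)  = ⊥-elim (B.face-∦-stars _ (∥-sym p))
  blocks-∥ (s0 ∷ _)   (star ∷ _)  (_ ∷ _)  _          (p ∷ _)  = ⊥-elim (B.face-∦-stars _ p)
  blocks-∥ (s1 ∷ _)   (star ∷ _)  (_ ∷ _)  _          (p ∷ _)  = ⊥-elim (B.face-∦-stars _ p)
  blocks-∥ (s0 ∷ a)   (s0 ∷ a′)   (c ∷ cs) (c′ ∷ cs′) (p ∷ ps) = fixed-∷-∥ (λ ()) (λ ()) p (blocks-∥ a a′ cs cs′ ps)
  blocks-∥ (s0 ∷ a)   (s1 ∷ a′)   (c ∷ cs) (c′ ∷ cs′) (p ∷ ps) = fixed-∷-∥ (λ ()) (λ ()) p (blocks-∥ a a′ cs cs′ ps)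
  blocks-∥ (s1 ∷ a)   (s0 ∷ a′)   (c ∷ cs) (c′ ∷ cs′) (p ∷ ps) = fixed-∷-∥ (λ ()) (λ ()) p (blocks-∥ a a′ cs cs′ ps)
  blocks-∥ (s1 ∷ a)   (s1 ∷ a′)   (c ∷ cs) (c′ ∷ cs′) (p ∷ ps) = fixed-∷-∥ (λ ()) (λ ()) p (blocks-∥ a a′ cs cs′ ps)


  collect : ∀ {k} (a : Face k) → Vec Chunk k → Vec Chunk (codim a)
  collect []         []       = []
  collect (star ∷ a) (_ ∷ cs) = collect a cs
  collect (s0 ∷ a)   (c ∷ cs) = c ∷ collect a cs
  collect (s1 ∷ a)   (c ∷ cs) = c ∷ collect a cs

  blocks-∋ : ∀ {k} (a : Face k) (ws : Vec (Vec Bool (suc m₂)) k) {ys : Vec (Vertex n₂) k} →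
             Pointwise (λ w y → B.face w ∋ y) ws ys → a ∋ map head ws →
             Pointwise _∋_ (blocks a (collect a (map tail ws))) ys
  blocks-∋ []         []                 []       []         = []
  blocks-∋ (star ∷ a) (_ ∷ ws)           (_ ∷ ps) (_ ∷ a∋)   = stars-∋ _ ∷ blocks-∋ a ws ps a∋
  blocks-∋ (s0 ∷ a)   ((_ ∷ _) ∷ ws)     (p ∷ ps) (m-0 ∷ a∋) = p ∷ blocks-∋ a ws ps a∋
  blocks-∋ (s1 ∷ a)   ((_ ∷ _) ∷ ws)     (p ∷ ps) (m-1 ∷ a∋) = p ∷ blocks-∋ a ws ps a∋

  covering-faces : ∀ {k} (ys : Vec (Vertex n₂) k) →
                   Pointwise (λ w y → B.face w ∋ y) (map (proj₁ ∘ B.cover) ys) ys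
  covering-faces []       = []
  covering-faces (y ∷ ys) = proj₂ (B.cover y) ∷ covering-faces ys

  m : ℕ
  m = m₁ + suc m₁ * m₂

  -- c indexes a face of A; the i-th row is the tail of the B-index used at its i-th fixed coordinate.
  faceOf : Vec Bool (suc m₁) → Vec Chunk (suc m₁) → Face (n₁ * n₂)
  faceOf c rows = substitute (A.face c) (cast (sym (A.codim-face c)) rows)

  face : Vec Bool (suc m) → Face (n₁ * n₂)
  face v = uncurry faceOf (splitRows (suc m₁) (suc m₁) m₂ v)

  face-joinRows : ∀ c rows → face (joinRows c rows) ≡ faceOf c rows
  face-joinRows c rows = cong (uncurry faceOf) (splitRows-joinRows c rows)

  face-flip : ∀ b c → face (not b ∷ c) ≡ anti (face (b ∷ c))
  face-flip b c = substitute-anti (A.face-flip b _) _ _ _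

  codim-faceOf : ∀ c rows → codim (faceOf c rows) ≡ suc m
  codim-faceOf c rows = begin
    codim (faceOf c rows)       ≡⟨ codim-substitute (A.face c) _ ⟩
    codim (A.face c) * suc m₂   ≡⟨ cong (_* suc m₂) (A.codim-face c) ⟩
    suc m₁ * suc m₂             ≡⟨ *-suc (suc m₁) m₂ ⟩
    suc m                       ∎
    where open ≡-Reasoning

  cover : ∀ x → ∃[ v ] face v ∋ x
  cover x = joinRows c rows , subst₂ _∋_ (sym face≡) (sym x≡concat) (Pointwise.concat⁺ blocks∋ys)
    where
    ys = proj₁ (group n₁ n₂ x)
    x≡concat = proj₂ (group n₁ n₂ x)
    ws = map (proj₁ ∘ B.cover) ys
    c = proj₁ (A.cover (map head ws))
    chunks = collect (A.face c) (map tail ws)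
    rows = cast (A.codim-face c) chunks
    blocks∋ys = blocks-∋ (A.face c) ws (covering-faces ys) (proj₂ (A.cover (map head ws)))
    face≡ : face (joinRows c rows) ≡ substitute (A.face c) chunks
    face≡ = trans (face-joinRows c rows)
                  (cong (substitute (A.face c)) (trans (cast-trans _ _ chunks) (cast-is-id _ chunks)))

  ∥⇒tail≡ : ∀ v w → face v ∥ face w → tail v ≡ tail w
  ∥⇒tail≡ v w p = begin
    tail v                   ≡⟨ cong tail (joinRows-splitRows (suc m₁) (suc m₁) m₂ v) ⟨
    tail (joinRows c rows)   ≡⟨ tail-joinRows c rows ⟩
    tail c ++ concat rows    ≡⟨ cong₂ (λ t r → t ++ concat r) (A.∥⇒tail≡ c c′ (proj₁ blocks∥)) rows≡rows′ ⟩
    tail c′ ++ concat rows′  ≡⟨ tail-joinRows c′ rows′ ⟨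
    tail (joinRows c′ rows′) ≡⟨ cong tail (joinRows-splitRows (suc m₁) (suc m₁) m₂ w) ⟩
    tail w                   ∎
    where
    open ≡-Reasoning
    c = proj₁ (splitRows (suc m₁) (suc m₁) m₂ v)
    rows = proj₂ (splitRows (suc m₁) (suc m₁) m₂ v)
    c′ = proj₁ (splitRows (suc m₁) (suc m₁) m₂ w)
    rows′ = proj₂ (splitRows (suc m₁) (suc m₁) m₂ w)
    blocks∥ = blocks-∥ (A.face c) (A.face c′) _ _ (Pointwise.concat⁻ _ _ p)
    rows≡rows′ : rows ≡ rows′
    rows≡rows′ = trans (sym (cast-is-id refl rows)) (toList-injective refl rows rows′
      (trans (sym (toList-cast _ rows)) (trans (proj₂ blocks∥) (toList-cast _ rows′))))

  product : SignedSplitting (n₁ * n₂) m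
  product = record
    { face       = face
    ; face-flip  = face-flip
    ; codim-face = λ v → codim-faceOf _ _
    ; cover      = cover
    ; ∥⇒tail≡    = ∥⇒tail≡
    }

Splittable : ℕ → ℕ → Set
Splittable n k = ∃[ m ] suc m ≡ k × SignedSplitting n m

splittable-* : ∀ {n₁ k₁ n₂ k₂} → Splittable n₁ k₁ → Splittable n₂ k₂ → Splittable (n₁ * n₂) (k₁ * k₂)
splittable-* (m₁ , refl , A) (m₂ , refl , B) = _ , sym (*-suc (suc m₁) m₂) , Product.product A B

splittable⇒antipodal : ∀ {n k} → Splittable n k → AntipodalSplitting n k
splittable⇒antipodal (_ , refl , S) = SignedSplitting.antipodalSplitting S

signed : ∀ {n m} → (Vec Bool m → Face n) → Vec Bool (suc m) → Face n
signed G (true ∷ c)  = G c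
signed G (false ∷ c) = anti (G c)

module _ {n m : ℕ} (G : Vec Bool m → Face n) where

  SplittingConditions : Set
  SplittingConditions = (∀ v → codim (signed G v) ≡ suc m)
                      × (∀ x → ∃[ v ] signed G v ∋ x)
                      × (∀ v w → signed G v ∥ signed G w → tail v ≡ tail w)

  splittingConditions? : Dec SplittingConditions
  splittingConditions? =
    all-bits? (λ v → codim (signed G v) ℕ.≟ suc m)
    ×-dec all-bits? (λ x → any-bits? λ v → Pointwise.decidable Matches? (signed G v) x)
    ×-dec all-bits? (λ v → all-bits? λ w →
            Pointwise.decidable _∥ₛ?_ (signed G v) (signed G w) →-dec ≡-dec Bool._≟_ (tail v) (tail w))

  signed-flip : ∀ b c → signed G (not b ∷ c) ≡ anti (signed G (b ∷ c))
  signed-flip true  c = refl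
  signed-flip false c = sym (anti-involutive (G c))

  signedSplitting : {True splittingConditions?} → SignedSplitting n m
  signedSplitting {conditions} =
    let codim-face , cover , ∥⇒tail≡ = toWitness conditions
    in record
      { face = signed G ; face-flip = signed-flip ; codim-face = codim-face ; cover = cover ; ∥⇒tail≡ = ∥⇒tail≡ }

splittable-1-1 : Splittable 1 1
splittable-1-1 = 0 , refl , signedSplitting λ { [] → s1 ∷ [] }

splittable-4-3 : Splittable 4 3
splittable-4-3 = 2 , refl , signedSplitting λ where
  (false ∷ false ∷ []) → s0 ∷ s1 ∷ star ∷ s1 ∷ []
  (false ∷ true ∷ [])  → s0 ∷ s0 ∷ s0 ∷ star ∷ []
  (true ∷ false ∷ [])  → s0 ∷ star ∷ s1 ∷ s0 ∷ []
  (true ∷ true ∷ [])   → star ∷ s0 ∷ s1 ∷ s1 ∷ []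

splittable-8-5 : Splittable 8 5
splittable-8-5 = 4 , refl , signedSplitting λ where
  (false ∷ false ∷ false ∷ false ∷ []) → star ∷ star ∷ s0 ∷ s1 ∷ s1 ∷ s1 ∷ s1 ∷ star ∷ []
  (false ∷ false ∷ false ∷ true ∷ [])  → s0 ∷ s0 ∷ s1 ∷ star ∷ s1 ∷ star ∷ star ∷ s1 ∷ []
  (false ∷ false ∷ true ∷ false ∷ [])  → s0 ∷ s1 ∷ s1 ∷ star ∷ star ∷ s1 ∷ star ∷ s1 ∷ []
  (false ∷ false ∷ true ∷ true ∷ [])   → star ∷ s0 ∷ s1 ∷ star ∷ s0 ∷ s1 ∷ star ∷ s1 ∷ []
  (false ∷ true ∷ false ∷ false ∷ [])  → s0 ∷ s0 ∷ star ∷ s1 ∷ star ∷ s0 ∷ star ∷ s0 ∷ []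
  (false ∷ true ∷ false ∷ true ∷ [])   → star ∷ s0 ∷ star ∷ s1 ∷ s0 ∷ s0 ∷ star ∷ s1 ∷ []
  (false ∷ true ∷ true ∷ false ∷ [])   → s0 ∷ star ∷ star ∷ s0 ∷ s0 ∷ s0 ∷ s1 ∷ star ∷ []
  (false ∷ true ∷ true ∷ true ∷ [])    → s0 ∷ star ∷ s0 ∷ s0 ∷ s1 ∷ star ∷ star ∷ s1 ∷ []
  (true ∷ false ∷ false ∷ false ∷ [])  → star ∷ star ∷ s0 ∷ s1 ∷ s1 ∷ s0 ∷ star ∷ s1 ∷ []
  (true ∷ false ∷ false ∷ true ∷ [])   → s0 ∷ star ∷ s0 ∷ s1 ∷ star ∷ s1 ∷ s0 ∷ star ∷ []
  (true ∷ false ∷ true ∷ false ∷ [])   → s0 ∷ s0 ∷ star ∷ s0 ∷ s1 ∷ star ∷ star ∷ s0 ∷ []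
  (true ∷ false ∷ true ∷ true ∷ [])    → s0 ∷ star ∷ s0 ∷ star ∷ s0 ∷ s1 ∷ s1 ∷ star ∷ []
  (true ∷ true ∷ false ∷ false ∷ [])   → s0 ∷ s1 ∷ s1 ∷ star ∷ s1 ∷ s0 ∷ star ∷ star ∷ []
  (true ∷ true ∷ false ∷ true ∷ [])    → s0 ∷ star ∷ s1 ∷ s1 ∷ star ∷ s1 ∷ star ∷ s0 ∷ []
  (true ∷ true ∷ true ∷ false ∷ [])    → s0 ∷ star ∷ s0 ∷ s0 ∷ s0 ∷ star ∷ s0 ∷ star ∷ []
  (true ∷ true ∷ true ∷ true ∷ [])     → s0 ∷ s1 ∷ star ∷ s1 ∷ s0 ∷ s0 ∷ star ∷ star ∷ []

splittable-^ : ∀ {n k} → Splittable n k → ∀ j → Splittable (n ^ j) (k ^ j)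
splittable-^ S zero    = splittable-1-1
splittable-^ S (suc j) = splittable-* S (splittable-^ S j)

corollary1 : ∀ (t p : ℕ) → t ≥ 1 → p ≥ 1 →
    AntipodalSplitting (2 ^ (2 * t + 3 * p)) (3 ^ t * 5 ^ p)
corollary1 t p _ _ = splittable⇒antipodal splitting
  where
  2^[2t+3p]≡4^t*8^p : 2 ^ (2 * t + 3 * p) ≡ 4 ^ t * 8 ^ p
  2^[2t+3p]≡4^t*8^p = trans (^-distribˡ-+-* 2 (2 * t) (3 * p)) (sym (cong₂ _*_ (^-*-assoc 2 2 t) (^-*-assoc 2 3 p)))
  splitting : Splittable (2 ^ (2 * t + 3 * p)) (3 ^ t * 5 ^ p)
  splitting = subst (λ n → Splittable n (3 ^ t * 5 ^ p)) (sym 2^[2t+3p]≡4^t*8^p)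
                    (splittable-* (splittable-^ splittable-4-3 t) (splittable-^ splittable-8-5 p))
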